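{- Let $b\ge 2$ be an integer with $b\equiv 16518444216571\pmod{18446744073709551615}$. Then there are infinitely many $b$-repunits that are Riesel numbers.
   Context: For $b\ge2$ and $t\ge1$, the $b$-repunit $1_b^{(t)}$ is $(b^t-1)/(b-1)$. A Riesel number is an odd positive integer $k$ such that $k\cdot 2^n-1$ is composite for all positive integers $n$. -}

module Defs where

open import Data.Nat using (ℕ; suc; _+_; _*_; _∸_; _^_; _≤_; _%_; _/_)
open import Data.Nat.Primality using (Composite)
open import Data.Product using (∃)
open import Relation.Binary.PropositionalEquality using (_≡_)

-- The b-repunit 1_b^(t) = (b^t - 1)/(b - 1). The divisor b - 1 is written
-- suc (b ∸ 2), which equals b - 1 whenever b ≥ 2 (the only case used).
repunit : ℕ → ℕ → ℕ
repunit b t = (b ^ t ∸ 1) / suc (b ∸ 2)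

Odd : ℕ → Set
Odd k = k % 2 ≡ 1

Riesel : ℕ → Set
Riesel k = Odd k × (∀ n → 1 ≤ n → Composite (k * 2 ^ n ∸ 1))
  where open import Data.Product using (_×_)

{-# OPTIONS --safe #-}
module Submission where

-- Write M = 2⁶⁴ − 1 = 3 · 5 · 17 · 257 · 641 · 65537 · 6700417. There is a residue class
-- modulo M such that for every k in it and every n, one of these seven primes divides
-- k · 2ⁿ − 1 (a covering system of exponents modulo 64), so every large k in the class is
-- a Riesel number. On the repunit side, b ≡ b₀ (mod M) gives 1_b^(t) ≡ 1_{b₀}^(t) (mod M),
-- which is periodic in t; one odd t₀ with 1_{b₀}^(t₀) in the class, shifted by multiples of
-- an even period, gives infinitely many odd repunits in it.

open import Defs
open import Data.Nat using (ℕ; _≤_; _%_)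
open import Data.Product using (Σ; _×_)
open import Relation.Binary.PropositionalEquality using (_≡_)

open import Data.Nat.Base
  using (zero; suc; _+_; _*_; _∸_; _^_; _<_; _/_; z≤n; s≤s; NonZero; NonTrivial; nonTrivial⇒nonZero; nonTrivial⇒n>1)
open import Data.Nat.Properties
  using (_≟_; _≤?_; ≤-trans; +-identityʳ; *-identityʳ; *-comm; ^-distribˡ-+-*; ^-*-assoc;
         m≤m+n; m≤n+m; m≤m*n; m^n≢0; ∸-monoˡ-≤)
open import Data.Nat.DivMod
  using (%-distribˡ-+; %-distribˡ-*; %-remove-+ʳ; m%n%n≡m%n; m%n≤m; m%n<n; m*n/n≡m;
         m≡m%n+[m/n]*n; m∣n⇒o%n%m≡o%m; m<n⇒m%n≡m)
open import Data.Nat.Divisibility using (_∣_; _∣?_; divides; _∣0; ∣m∣n⇒∣m+n; ∣n⇒∣m*n; m%n≡0⇒n∣m)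
open import Data.Nat.Primality using (Composite; composite)
open import Data.Nat.Binary.Base using (ℕᵇ; zero; 2[1+_]; 1+[2_]) renaming (toℕ to toℕᵇ; fromℕ to fromℕᵇ)
open import Data.Nat.Binary.Properties using (toℕ-fromℕ)
open import Data.Nat.Tactic.RingSolver using (solve-∀)
open import Data.Fin.Base using (Fin; toℕ; fromℕ<)
open import Data.Fin.Properties using (toℕ-fromℕ<) renaming (all? to allFin?)
open import Data.List.Base using (List; []; _∷_)
open import Data.List.Relation.Unary.All as All using (All; all?; lookupAny)
open import Data.List.Relation.Unary.Any as Any using (Any; any?)
open import Data.Product using (_,_; proj₁)
open import Relation.Nullary.Decidable using (from-yes; _×-dec_)
open import Relation.Unary using (Decidable)
open import Relation.Binary.PropositionalEquality using (refl; sym; trans; cong; cong₂; subst; module ≡-Reasoning)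
open ≡-Reasoning

module _ {d : ℕ} .{{_ : NonZero d}} where

  +-cong-% : ∀ {a b x y} → a % d ≡ b % d → x % d ≡ y % d → (a + x) % d ≡ (b + y) % d
  +-cong-% {a} {b} {x} {y} a≡b x≡y = begin
    (a + x) % d           ≡⟨ %-distribˡ-+ a x d ⟩
    (a % d + x % d) % d   ≡⟨ cong₂ (λ u v → (u + v) % d) a≡b x≡y ⟩
    (b % d + y % d) % d   ≡⟨ sym (%-distribˡ-+ b y d) ⟩
    (b + y) % d           ∎

  *-cong-% : ∀ {a b x y} → a % d ≡ b % d → x % d ≡ y % d → (a * x) % d ≡ (b * y) % d
  *-cong-% {a} {b} {x} {y} a≡b x≡y = begin
    (a * x) % d           ≡⟨ %-distribˡ-* a x d ⟩
    (a % d * (x % d)) % d ≡⟨ cong₂ (λ u v → (u * v) % d) a≡b x≡y ⟩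
    (b % d * (y % d)) % d ≡⟨ sym (%-distribˡ-* b y d) ⟩
    (b * y) % d           ∎

  %≡1⇒∣∸1 : ∀ x → x % d ≡ 1 → d ∣ x ∸ 1
  %≡1⇒∣∸1 x x%d≡1 = divides (x / d) (begin
    x ∸ 1                   ≡⟨ cong (_∸ 1) (m≡m%n+[m/n]*n x d) ⟩
    x % d + x / d * d ∸ 1   ≡⟨ cong (λ r → r + x / d * d ∸ 1) x%d≡1 ⟩
    x / d * d               ∎)

geometricSum : ℕ → ℕ → ℕ
geometricSum b zero    = 0
geometricSum b (suc t) = 1 + b * geometricSum b t

geometricSum-+ : ∀ b m n → geometricSum b (m + n) ≡ geometricSum b m + b ^ m * geometricSum b n
geometricSum-+ b zero    n = sym (+-identityʳ (geometricSum b n))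
geometricSum-+ b (suc m) n = begin
  1 + b * geometricSum b (m + n)                          ≡⟨ cong (λ s → 1 + b * s) (geometricSum-+ b m n) ⟩
  1 + b * (geometricSum b m + b ^ m * geometricSum b n)   ≡⟨ distrib b (geometricSum b m) (b ^ m) (geometricSum b n) ⟩
  1 + b * geometricSum b m + b * b ^ m * geometricSum b n ∎
  where
  distrib : ∀ b s p u → 1 + b * (s + p * u) ≡ 1 + b * s + b * p * u
  distrib = solve-∀

geometricSum-1 : ∀ t → geometricSum 1 t ≡ t
geometricSum-1 zero    = refl
geometricSum-1 (suc t) = cong suc (trans (+-identityʳ (geometricSum 1 t)) (geometricSum-1 t))

^≡1+geometricSum* : ∀ b t → suc b ^ t ≡ 1 + geometricSum (suc b) t * b
^≡1+geometricSum* b zero    = refl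
^≡1+geometricSum* b (suc t) = begin
  suc b * suc b ^ t                            ≡⟨ cong (suc b *_) (^≡1+geometricSum* b t) ⟩
  suc b * (1 + geometricSum (suc b) t * b)     ≡⟨ expand b (geometricSum (suc b) t) ⟩
  1 + (1 + suc b * geometricSum (suc b) t) * b ∎
  where
  expand : ∀ b s → (1 + b) * (1 + s * b) ≡ 1 + (1 + (1 + b) * s) * b
  expand = solve-∀

repunit≡geometricSum : ∀ b t → 2 ≤ b → repunit b t ≡ geometricSum b t
repunit≡geometricSum b@(suc (suc m)) t (s≤s (s≤s z≤n)) = begin
  (b ^ t ∸ 1) / suc m              ≡⟨ cong (λ x → (x ∸ 1) / suc m) (^≡1+geometricSum* (suc m) t) ⟩
  geometricSum b t * suc m / suc m ≡⟨ m*n/n≡m (geometricSum b t) (suc m) ⟩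
  geometricSum b t                 ∎

b≤repunit : ∀ {b t} → 2 ≤ b → 2 ≤ t → b ≤ repunit b t
b≤repunit {b} {suc zero}        _   (s≤s ())
b≤repunit {b} {t@(suc (suc u))} 2≤b _ =
  subst (b ≤_) (sym (repunit≡geometricSum b t 2≤b))
        (≤-trans (m≤m*n b (geometricSum b (suc u))) (m≤n+m _ 1))

module _ {d : ℕ} .{{_ : NonZero d}} where

  geometricSum-cong-% : ∀ {b c} t → b % d ≡ c % d → geometricSum b t % d ≡ geometricSum c t % d
  geometricSum-cong-% zero    _   = refl
  geometricSum-cong-% (suc t) b≡c = +-cong-% {a = 1} refl (*-cong-% b≡c (geometricSum-cong-% t b≡c))

  geometricSum-periodic : ∀ {b L} t N → d ∣ geometricSum b L →
                          geometricSum b (t + N * L) % d ≡ geometricSum b t % d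
  geometricSum-periodic {b} {L} t N d∣S = begin
    geometricSum b (t + N * L) % d                            ≡⟨ cong (_% d) (geometricSum-+ b t (N * L)) ⟩
    (geometricSum b t + b ^ t * geometricSum b (N * L)) % d   ≡⟨ %-remove-+ʳ _ (∣n⇒∣m*n (b ^ t) (multiples N)) ⟩
    geometricSum b t % d                                      ∎
    where
    multiples : ∀ N → d ∣ geometricSum b (N * L)
    multiples zero    = d ∣0
    multiples (suc N) = subst (d ∣_) (sym (geometricSum-+ b L (N * L)))
                              (∣m∣n⇒∣m+n d∣S (∣n⇒∣m*n (b ^ L) (multiples N)))

-- Modulo 2 the ratio is 0 or 1, so the sum is 1 or t.
repunit-odd : ∀ {b t} → 2 ≤ b → Odd t → Odd (repunit b t)
repunit-odd {b} {zero}    _   ()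
repunit-odd {b} {t@(suc _)} 2≤b t-odd =
  subst Odd (sym (repunit≡geometricSum b t 2≤b))
        (trans (geometricSum-cong-% {b = b} {c = b % 2} t (sym (m%n%n≡m%n b 2))) (by-parity (b % 2) (m%n<n b 2)))
  where
  by-parity : ∀ c → c < 2 → Odd (geometricSum c t)
  by-parity 0 _ = refl
  by-parity 1 _ = trans (cong (_% 2) (geometricSum-1 t)) t-odd
  by-parity (suc (suc _)) (s≤s (s≤s ()))

-- Square-and-multiply evaluation of (geometricSum b n % d , b ^ n % d) along the binary
-- expansion of n, for exponents far too large to unfold.
module GeometricResidues (b d : ℕ) .{{_ : NonZero d}} where

  residues : ℕ → ℕ × ℕ
  residues n = geometricSum b n % d , b ^ n % d

  step : ℕ × ℕ → ℕ × ℕ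
  step (s , p) = (1 + b * s) % d , (b * p) % d

  double : ℕ × ℕ → ℕ × ℕ
  double (s , p) = (s + p * s) % d , (p * p) % d

  step-residues : ∀ n → step (residues n) ≡ residues (suc n)
  step-residues n = cong₂ _,_
    (+-cong-% {a = 1} refl (*-cong-% {a = b} refl (m%n%n≡m%n (geometricSum b n) d)))
    (*-cong-% {a = b} refl (m%n%n≡m%n (b ^ n) d))

  double-residues : ∀ n → double (residues n) ≡ residues (2 * n)
  double-residues n = begin
    double (residues n)
      ≡⟨ cong₂ _,_ (+-cong-% s%d%d (*-cong-% p%d%d s%d%d)) (*-cong-% p%d%d p%d%d) ⟩
    (s + p * s) % d , (p * p) % d
      ≡⟨ cong₂ (λ u v → u % d , v % d) (sym (geometricSum-+ b n n)) (sym (^-distribˡ-+-* b n n)) ⟩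
    residues (n + n)
      ≡⟨ cong (λ k → residues (n + k)) (sym (+-identityʳ n)) ⟩
    residues (2 * n)
      ∎
    where
    s = geometricSum b n
    p = b ^ n
    s%d%d = m%n%n≡m%n s d
    p%d%d = m%n%n≡m%n p d

  residuesᵇ : ℕᵇ → ℕ × ℕ
  residuesᵇ zero      = residues 0
  residuesᵇ 2[1+ x ] = double (step (residuesᵇ x))
  residuesᵇ 1+[2 x ] = step (double (residuesᵇ x))

  residuesᵇ-correct : ∀ x → residuesᵇ x ≡ residues (toℕᵇ x)
  residuesᵇ-correct zero      = refl
  residuesᵇ-correct 2[1+ x ] = begin
    double (step (residuesᵇ x))   ≡⟨ cong (λ r → double (step r)) (residuesᵇ-correct x) ⟩
    double (step (residues n))    ≡⟨ cong double (step-residues n) ⟩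
    double (residues (suc n))     ≡⟨ double-residues (suc n) ⟩
    residues (2 * suc n)          ∎
    where n = toℕᵇ x
  residuesᵇ-correct 1+[2 x ] = begin
    step (double (residuesᵇ x))   ≡⟨ cong (λ r → step (double r)) (residuesᵇ-correct x) ⟩
    step (double (residues n))    ≡⟨ cong step (double-residues n) ⟩
    step (residues (2 * n))       ≡⟨ step-residues (2 * n) ⟩
    residues (suc (2 * n))        ∎
    where n = toℕᵇ x

  geometricSum-%-binary : ∀ n → geometricSum b n % d ≡ proj₁ (residuesᵇ (fromℕᵇ n))
  geometricSum-%-binary n = cong proj₁ (begin
    residues n                    ≡⟨ cong residues (sym (toℕ-fromℕ n)) ⟩
    residues (toℕᵇ (fromℕᵇ n))    ≡⟨ sym (residuesᵇ-correct (fromℕᵇ n)) ⟩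
    residuesᵇ (fromℕᵇ n)          ∎)

open GeometricResidues using (geometricSum-%-binary)

-- Declared only here: earlier on it would be preferred to the library instance for NonZero (suc n)
-- and then fail.
private instance
  nonTrivial⇒nonZero′ : ∀ {n} → .{{NonTrivial n}} → NonZero n
  nonTrivial⇒nonZero′ {n} = nonTrivial⇒nonZero n

module _ {d : ℕ} .{{_ : NonTrivial d}} where

  1%d≡1 : 1 % d ≡ 1
  1%d≡1 = m<n⇒m%n≡m (nonTrivial⇒n>1 d)

  %≡1⇒^%≡1 : ∀ {x} q → x % d ≡ 1 → x ^ q % d ≡ 1
  %≡1⇒^%≡1     zero    _     = 1%d≡1
  %≡1⇒^%≡1 {x} (suc q) x%d≡1 = begin
    (x * x ^ q) % d             ≡⟨ %-distribˡ-* x (x ^ q) d ⟩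
    (x % d * (x ^ q % d)) % d   ≡⟨ cong₂ (λ u v → (u * v) % d) x%d≡1 (%≡1⇒^%≡1 q x%d≡1) ⟩
    1 % d                       ≡⟨ 1%d≡1 ⟩
    1                           ∎

  ^-%-periodic : ∀ {x m} .{{_ : NonZero m}} n → x ^ m % d ≡ 1 → x ^ n % d ≡ x ^ (n % m) % d
  ^-%-periodic {x} {m} n xᵐ≡1 = begin
    x ^ n % d                  ≡⟨ cong (λ e → x ^ e % d) (m≡m%n+[m/n]*n n m) ⟩
    x ^ (r + q * m) % d        ≡⟨ cong (_% d) (^-distribˡ-+-* x r (q * m)) ⟩
    x ^ r * x ^ (q * m) % d    ≡⟨ cong (λ e → x ^ r * x ^ e % d) (*-comm q m) ⟩
    x ^ r * x ^ (m * q) % d    ≡⟨ cong (λ y → x ^ r * y % d) (sym (^-*-assoc x m q)) ⟩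
    x ^ r * (x ^ m) ^ q % d    ≡⟨ *-cong-% {d = d} {a = x ^ r} refl (trans (%≡1⇒^%≡1 q xᵐ≡1) (sym 1%d≡1)) ⟩
    x ^ r * 1 % d              ≡⟨ cong (_% d) (*-identityʳ (x ^ r)) ⟩
    x ^ r % d                  ∎
    where
    r = n % m
    q = n / m

record Class : Set where
  constructor _mod_
  field
    residue modulus : ℕ
    .{{modulus-nonTrivial}} : NonTrivial modulus

infix 6 _mod_
open Class using (modulus)

_∈ᶜ_ : ℕ → Class → Set
k ∈ᶜ (a mod p) = k % p ≡ a % p

_∈ᶜ?_ : ∀ k → Decidable (k ∈ᶜ_)
k ∈ᶜ? (a mod p) = k % p ≟ a % p

Catches : ℕ → Class → Set
Catches r (a mod p) = a * 2 ^ r % p ≡ 1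

catches? : ∀ r → Decidable (Catches r)
catches? r (a mod p) = a * 2 ^ r % p ≟ 1

TwoHasPeriod : ℕ → Class → Set
TwoHasPeriod m (a mod p) = 2 ^ m % p ≡ 1

twoHasPeriod? : ∀ m → Decidable (TwoHasPeriod m)
twoHasPeriod? m (a mod p) = 2 ^ m % p ≟ 1

∈ᶜ-via-multiple : ∀ {k K D} .{{_ : NonZero D}} cl → modulus cl ∣ D → k % D ≡ K → K ∈ᶜ cl → k ∈ᶜ cl
∈ᶜ-via-multiple {k} {K} {D} (a mod p) p∣D k≡K K∈cl = begin
  k % p       ≡⟨ sym (m∣n⇒o%n%m≡o%m p D k p∣D) ⟩
  k % D % p   ≡⟨ cong (_% p) k≡K ⟩
  K % p       ≡⟨ K∈cl ⟩
  a % p       ∎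

composite-by-class : ∀ {m k} .{{_ : NonZero m}} n cl → TwoHasPeriod m cl → Catches (n % m) cl →
                     k ∈ᶜ cl → 2 + modulus cl ≤ k → Composite (k * 2 ^ n ∸ 1)
composite-by-class {m} {k} n (a mod p) period catches k∈cl p+2≤k =
  composite p<k2ⁿ∸1 (%≡1⇒∣∸1 (k * 2 ^ n) k2ⁿ≡1)
  where
  k2ⁿ≡1 : k * 2 ^ n % p ≡ 1
  k2ⁿ≡1 = trans (*-cong-% {d = p} k∈cl (^-%-periodic {d = p} n period)) catches
  p<k2ⁿ∸1 : p < k * 2 ^ n ∸ 1
  p<k2ⁿ∸1 = ≤-trans (∸-monoˡ-≤ 1 p+2≤k) (∸-monoˡ-≤ 1 (m≤m*n k (2 ^ n) {{m^n≢0 2 n}}))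

covering⇒composite : ∀ {m cs k} .{{_ : NonZero m}} →
                     All (TwoHasPeriod m) cs → ((r : Fin m) → Any (Catches (toℕ r)) cs) →
                     All (λ cl → k ∈ᶜ cl × 2 + modulus cl ≤ k) cs →
                     ∀ n → Composite (k * 2 ^ n ∸ 1)
covering⇒composite {m} periods covers members n =
  let n%m<m = m%n<n n m
      caught = covers (fromℕ< n%m<m)
      (period , k∈cl , p+2≤k) , catches = lookupAny (All.zip (periods , members)) caught
      cl = Any.lookup caught
  in composite-by-class n cl period (subst (λ r → Catches r cl) (toℕ-fromℕ< n%m<m) catches) k∈cl p+2≤k

M : ℕ
M = 2 ^ 64 ∸ 1

-- 2^(2^j) ≡ −1 modulo the Fermat primes 3, 5, 17, 257, 65537 (j = 0, …, 4) and modulo 641 ∣ F₅ (j = 5),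
-- so k ≡ −1 catches the exponents n with 2^j ∥ n; 6700417 = F₅ / 641 catches 64 ∣ n with k ≡ 1.
rieselClasses : List Class
rieselClasses =
  2 mod 3 ∷ 4 mod 5 ∷ 16 mod 17 ∷ 256 mod 257 ∷ 65536 mod 65537 ∷ 640 mod 641 ∷ 1 mod 6700417 ∷ []

-- The residue modulo M lying in every class of rieselClasses (Chinese remainder theorem).
rieselResidue : ℕ
rieselResidue = 2935363327246958234

rieselResidue⇒composite : ∀ {k} → k % M ≡ rieselResidue → 6700419 ≤ k → ∀ n → Composite (k * 2 ^ n ∸ 1)
rieselResidue⇒composite {k} k≡K 6700419≤k = covering⇒composite {64} periods covers members
  where
  periods : All (TwoHasPeriod 64) rieselClasses
  periods = from-yes (all? (twoHasPeriod? 64) rieselClasses)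
  covers : (r : Fin 64) → Any (Catches (toℕ r)) rieselClasses
  covers = from-yes (allFin? {64} λ r → any? (catches? (toℕ r)) rieselClasses)
  facts : All (λ cl → modulus cl ∣ M × rieselResidue ∈ᶜ cl × 2 + modulus cl ≤ 6700419) rieselClasses
  facts = from-yes (all? (λ cl → modulus cl ∣? M ×-dec rieselResidue ∈ᶜ? cl ×-dec 2 + modulus cl ≤? 6700419)
                         rieselClasses)
  members : All (λ cl → k ∈ᶜ cl × 2 + modulus cl ≤ k) rieselClasses
  members = All.map (λ {cl} (p∣M , K∈cl , small) → ∈ᶜ-via-multiple cl p∣M k≡K K∈cl , ≤-trans small 6700419≤k)
                    facts

b₀ : ℕ
b₀ = 16518444216571

-- period = P · 2233472 with P = M / 6700417 and 2233472 the order of b₀ modulo 6700417, so M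
-- divides geometricSum b₀ period; t₀ is the solution of t₀ ≡ −1 (mod P), t₀ ≡ 1 (mod 2233472).
-- Opaque, since unfolded numerals would let the type checker expand t₀ + N * period into a
-- tower of 5 · 10¹⁸ successors.
opaque
  t₀ : ℕ
  t₀ = 5566401850543975169

  period : ℕ
  period = 6148913773545171840

  2≤t₀ : 2 ≤ t₀
  2≤t₀ = s≤s (s≤s z≤n)

  t₀-odd : Odd t₀
  t₀-odd = refl

  2∣period : 2 ∣ period
  2∣period = divides (period / 2) refl

  period≢0 : NonZero period
  period≢0 = _

  M∣geometricSum-period : M ∣ geometricSum b₀ period
  M∣geometricSum-period = m%n≡0⇒n∣m _ M (geometricSum-%-binary b₀ M period)

  geometricSum-t₀ : geometricSum b₀ t₀ % M ≡ rieselResidue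
  geometricSum-t₀ = geometricSum-%-binary b₀ M t₀

repunit%M≡rieselResidue : ∀ {b} N → 2 ≤ b → b % M ≡ b₀ → repunit b (t₀ + N * period) % M ≡ rieselResidue
repunit%M≡rieselResidue {b} N 2≤b b≡b₀ = begin
  repunit b t % M              ≡⟨ cong (_% M) (repunit≡geometricSum b t 2≤b) ⟩
  geometricSum b t % M         ≡⟨ geometricSum-cong-% t b≡b₀ ⟩
  geometricSum b₀ t % M        ≡⟨ geometricSum-periodic t₀ N M∣geometricSum-period ⟩
  geometricSum b₀ t₀ % M       ≡⟨ geometricSum-t₀ ⟩
  rieselResidue                ∎
  where t = t₀ + N * period

corollary3p14 : (b : ℕ) → 2 ≤ b → b % 18446744073709551615 ≡ 16518444216571 →
    (N : ℕ) → Σ ℕ (λ t → N ≤ t × 1 ≤ t × Riesel (repunit b t))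
corollary3p14 b 2≤b b≡b₀ N =
  t , N≤t , ≤-trans (s≤s z≤n) 2≤t , repunit-odd {b} {t} 2≤b t-odd , composite-for-all
  where
  t = t₀ + N * period
  N≤t : N ≤ t
  N≤t = ≤-trans (m≤m*n N period {{period≢0}}) (m≤n+m (N * period) t₀)
  2≤t : 2 ≤ t
  2≤t = ≤-trans 2≤t₀ (m≤m+n t₀ (N * period))
  t-odd : Odd t
  t-odd = trans (%-remove-+ʳ t₀ (∣n⇒∣m*n N 2∣period)) t₀-odd
  6700419≤R : 6700419 ≤ repunit b t
  6700419≤R = ≤-trans (from-yes (6700419 ≤? b₀))
                (≤-trans (subst (_≤ b) b≡b₀ (m%n≤m b M)) (b≤repunit 2≤b 2≤t))
  composite-for-all : ∀ n → 1 ≤ n → Composite (repunit b t * 2 ^ n ∸ 1)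
  composite-for-all n _ = rieselResidue⇒composite (repunit%M≡rieselResidue N 2≤b b≡b₀) 6700419≤R n
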